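{- For every register set automaton with register emptiness test $\mathcal{A}$, there exists a register set automaton $\mathcal{A}'$ with $L(\mathcal{A}')=L(\mathcal{A})$.
   Context: Fix a finite nonempty alphabet $\Sigma$ and an infinite data domain $\mathbb{D}$. A register set automaton (RsA) is a tuple $(Q,R,\Delta,I,F)$ with $Q$ finite states, $R$ finite registers, $I,F\subseteq Q$, and transitions $q\xrightarrow{a\mid G^{\in},G^{\notin},up}s$ with $a\in\Sigma$, $G^{\in},G^{\notin}\subseteq R$ disjoint, $up\colon R\to 2^{R\cup\{\mathit{in}\}}$. Configurations are $(q,f)$ with $f\colon R\to 2^{\mathbb{D}}$; initial ones have $q\in I$ and all registers empty. A step over $(a,d)$ is possible iff $d\in f(r)$ for all $r\in G^{\in}$ and $d\notin f(r)$ for all $r\in G^{\notin}$; afterwards each register $r$ holds $\bigcup\{f(r')\mid r'\in R\cap up(r)\}$, plus $d$ if $\mathit{in}\in up(r)$. The language is the set of words with a run from an initial configuration ending in $F$. An RsA with register emptiness test is the same except that transitions have the form $q\xrightarrow{a\mid G^{\in},G^{\notin},G^{\emptyset},up}s$ with an additional $G^{\emptyset}\subseteq R$, and the step additionally requires $f(r)=\emptyset$ for all $r\in G^{\emptyset}$. -}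

module Defs where

open import Data.Nat using (ℕ; suc)
open import Data.Fin using (Fin)
open import Data.Fin.Subset using (Subset) renaming (_∈_ to _∈ₛ_; _∉_ to _∉ₛ_)
open import Data.Fin.Subset.Properties using (_∈?_)
open import Data.Bool using (Bool; true; false; if_then_else_)
open import Data.List using (List; []; _∷_; _++_; allFin; concatMap)
open import Data.List.Membership.Propositional using () renaming (_∈_ to _∈ₗ_; _∉_ to _∉ₗ_)
open import Data.Product using (Σ; _×_; _,_)
open import Relation.Binary.PropositionalEquality using (_≡_)
open import Relation.Nullary.Decidable using (⌊_⌋)
open import Function.Bundles using (_↔_; _↣_)

FiniteNonempty : Set → Set
FiniteNonempty A = Σ ℕ λ k → A ↔ Fin (suc k)

Infinite : Set → Set
Infinite D = ℕ ↣ D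

DataWord : Set → Set → Set
DataWord A D = List (A × D)

-- Register contents: each register holds a (finite) set of data values,
-- represented as a list (membership = list membership; empty set = []).
Regs : Set → ℕ → Set
Regs D m = Fin m → List D

emptyRegs : {D : Set} {m : ℕ} → Regs D m
emptyRegs _ = []

-- Update up : R → 2^(R ∪ {in}), represented as
-- upR : R → Subset R  (the registers in up(r)) and upIn : R → Bool (in ∈ up(r)).
update : {D : Set} {m : ℕ} → (Fin m → Subset m) → (Fin m → Bool) → Regs D m → D → Regs D m
update {m = m} upR upIn f d r =
  concatMap (λ r' → if ⌊ r' ∈? upR r ⌋ then f r' else []) (allFin m)
  ++ (if upIn r then d ∷ [] else [])

record Trans (A : Set) (n m : ℕ) : Set where
  field
    src   : Fin n
    lab   : A
    gIn   : Subset m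
    gNotIn : Subset m
    disj  : ∀ r → r ∈ₛ gIn → r ∉ₛ gNotIn
    upR   : Fin m → Subset m
    upIn  : Fin m → Bool
    tgt   : Fin n

record RsA (A : Set) : Set where
  field
    nQ : ℕ
    nR : ℕ
    Δ  : List (Trans A nQ nR)
    I  : Subset nQ
    F  : Subset nQ

data AccRsA {A D : Set} (𝒜 : RsA A) : Fin (RsA.nQ 𝒜) → Regs D (RsA.nR 𝒜) → DataWord A D → Set where
  done : ∀ {q f} → q ∈ₛ RsA.F 𝒜 → AccRsA 𝒜 q f []
  step : ∀ {q f a d w} (t : Trans A (RsA.nQ 𝒜) (RsA.nR 𝒜)) →
         t ∈ₗ RsA.Δ 𝒜 → Trans.src t ≡ q → Trans.lab t ≡ a →
         (∀ r → r ∈ₛ Trans.gIn t → d ∈ₗ f r) →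
         (∀ r → r ∈ₛ Trans.gNotIn t → d ∉ₗ f r) →
         AccRsA 𝒜 (Trans.tgt t) (update (Trans.upR t) (Trans.upIn t) f d) w →
         AccRsA 𝒜 q f ((a , d) ∷ w)

LangRsA : {A D : Set} → RsA A → DataWord A D → Set
LangRsA 𝒜 w = Σ _ λ q → q ∈ₛ RsA.I 𝒜 × AccRsA 𝒜 q emptyRegs w

record TransE (A : Set) (n m : ℕ) : Set where
  field
    src    : Fin n
    lab    : A
    gIn    : Subset m
    gNotIn : Subset m
    disj   : ∀ r → r ∈ₛ gIn → r ∉ₛ gNotIn
    gEmpty : Subset m
    upR    : Fin m → Subset m
    upIn   : Fin m → Bool
    tgt    : Fin n

record RsAE (A : Set) : Set where
  field
    nQ : ℕ
    nR : ℕ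
    Δ  : List (TransE A nQ nR)
    I  : Subset nQ
    F  : Subset nQ

data AccRsAE {A D : Set} (𝒜 : RsAE A) : Fin (RsAE.nQ 𝒜) → Regs D (RsAE.nR 𝒜) → DataWord A D → Set where
  done : ∀ {q f} → q ∈ₛ RsAE.F 𝒜 → AccRsAE 𝒜 q f []
  step : ∀ {q f a d w} (t : TransE A (RsAE.nQ 𝒜) (RsAE.nR 𝒜)) →
         t ∈ₗ RsAE.Δ 𝒜 → TransE.src t ≡ q → TransE.lab t ≡ a →
         (∀ r → r ∈ₛ TransE.gIn t → d ∈ₗ f r) →
         (∀ r → r ∈ₛ TransE.gNotIn t → d ∉ₗ f r) →
         (∀ r → r ∈ₛ TransE.gEmpty t → f r ≡ []) →
         AccRsAE 𝒜 (TransE.tgt t) (update (TransE.upR t) (TransE.upIn t) f d) w →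
         AccRsAE 𝒜 q f ((a , d) ∷ w)

LangRsAE : {A D : Set} → RsAE A → DataWord A D → Set
LangRsAE 𝒜 w = Σ _ λ q → q ∈ₛ RsAE.I 𝒜 × AccRsAE 𝒜 q emptyRegs w

{-# OPTIONS --safe #-}
-- The automaton without emptiness tests runs the given one while recording, in its
-- finite control, which registers are currently empty. This set evolves
-- deterministically: after an update, r is empty iff in ∉ up(r) and every register
-- in up(r) was empty. A G^∅ guard then becomes a condition on the recorded set,
-- checked when the transitions are built.
module Submission where

open import Defs
open import Data.Bool using (Bool; true; false; T; not; _∧_; _∨_; if_then_else_)
open import Data.Bool.ListAction using (and; all)
open import Data.Bool.Properties using (T-≡; ∨-identityʳ) renaming (_≟_ to _≟ᵇ_)
open import Data.Fin using (Fin; combine; remQuot; funToFin; finToFun)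
open import Data.Fin.Properties using (2↔Bool; finToFun-funToFin; remQuot-combine)
open import Data.Fin.Subset using (Subset; _⊆_; _∩_) renaming (_∈_ to _∈ₛ_)
open import Data.Fin.Subset.Properties using (_∈?_; _⊆?_; x∈p∩q⁺; x∈p∩q⁻)
open import Data.List using (List; []; _∷_; _++_; null; map; concatMap; allFin; filter; cartesianProduct)
open import Data.List.Membership.Propositional using () renaming (_∈_ to _∈ₗ_)
open import Data.List.Membership.Propositional.Properties
  using (∈-map⁺; ∈-map⁻; ∈-filter⁺; ∈-filter⁻; ∈-cartesianProduct⁺; ∈-cartesianProduct⁻; ∈-allFin)
open import Data.List.Properties using (map-cong)
open import Data.Nat using (ℕ; _*_; _^_)
open import Data.Product using (Σ; ∃; _×_; _,_; proj₁; proj₂; map₂)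
open import Data.Vec using (lookup; tabulate)
open import Data.Vec.Properties using (lookup∘tabulate; tabulate∘lookup; tabulate-cong; []=⇒lookup; lookup⇒[]=; ≡-dec)
open import Function using (_∘_; Inverse)
open import Function.Bundles using (_⇔_; mk⇔; Equivalence)
open import Function.Construct.Composition using (_⇔-∘_)
import Function.Properties.Equivalence as ⇔
open import Relation.Binary.PropositionalEquality
open import Relation.Nullary.Decidable using (⌊_⌋; toWitness; fromWitness)
open import Relation.Unary using (Decidable)

open Equivalence using (to; from)

private
  variable
    X Y : Set
    k m n : ℕ

null-++ : (xs ys : List X) → null (xs ++ ys) ≡ null xs ∧ null ys
null-++ []       ys = refl
null-++ (x ∷ xs) ys = refl

null-concatMap : (f : X → List Y) (xs : List X) → null (concatMap f xs) ≡ all (null ∘ f) xs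
null-concatMap f []       = refl
null-concatMap f (x ∷ xs) =
  trans (null-++ (f x) (concatMap f xs)) (cong (null (f x) ∧_) (null-concatMap f xs))

null-if : (b : Bool) (xs : List X) → null (if b then xs else []) ≡ not b ∨ null xs
null-if true  xs = refl
null-if false xs = refl

T-null⇔≡[] : {xs : List X} → T (null xs) ⇔ xs ≡ []
T-null⇔≡[] {xs = []}    = mk⇔ (λ _ → refl) (λ _ → _)
T-null⇔≡[] {xs = _ ∷ _} = mk⇔ (λ ()) (λ ())

∈⇔T-lookup : {i : Fin n} {s : Subset n} → i ∈ₛ s ⇔ T (lookup s i)
∈⇔T-lookup {i = i} {s} = mk⇔ (from T-≡ ∘ []=⇒lookup) (lookup⇒[]= i s ∘ to T-≡)

∈-tabulate⇔ : {p : Fin n → Bool} {i : Fin n} → i ∈ₛ tabulate p ⇔ T (p i)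
∈-tabulate⇔ {p = p} {i} =
  mk⇔ (subst T (lookup∘tabulate p i) ∘ to ∈⇔T-lookup)
      (from ∈⇔T-lookup ∘ subst T (sym (lookup∘tabulate p i)))

preimage : (Fin k → Fin n) → Subset n → Subset k
preimage g s = tabulate (lookup s ∘ g)

∈-preimage⇔ : {g : Fin k → Fin n} {s : Subset n} {i : Fin k} → i ∈ₛ preimage g s ⇔ g i ∈ₛ s
∈-preimage⇔ = ⇔.sym ∈⇔T-lookup ⇔-∘ ∈-tabulate⇔

encodeSubset : Subset m → Fin (2 ^ m)
encodeSubset s = funToFin (Inverse.from 2↔Bool ∘ lookup s)

decodeSubset : Fin (2 ^ m) → Subset m
decodeSubset i = tabulate (Inverse.to 2↔Bool ∘ finToFun i)

decodeSubset-encodeSubset : (s : Subset m) → decodeSubset (encodeSubset s) ≡ s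
decodeSubset-encodeSubset s = begin
  tabulate (Inverse.to 2↔Bool ∘ finToFun (funToFin (Inverse.from 2↔Bool ∘ lookup s)))
    ≡⟨ tabulate-cong (λ r → trans (cong (Inverse.to 2↔Bool) (finToFun-funToFin _ r))
                                  (Inverse.strictlyInverseˡ 2↔Bool (lookup s r))) ⟩
  tabulate (lookup s)
    ≡⟨ tabulate∘lookup s ⟩
  s ∎
  where open ≡-Reasoning

subsets : (m : ℕ) → List (Subset m)
subsets m = map decodeSubset (allFin (2 ^ m))

∈-subsets : (s : Subset m) → s ∈ₗ subsets m
∈-subsets s =
  subst (_∈ₗ subsets _) (decodeSubset-encodeSubset s) (∈-map⁺ decodeSubset (∈-allFin (encodeSubset s)))

encodePair : Fin n × Subset m → Fin (n * 2 ^ m)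
encodePair (q , s) = combine q (encodeSubset s)

decodePair : Fin (n * 2 ^ m) → Fin n × Subset m
decodePair {m = m} i = map₂ decodeSubset (remQuot (2 ^ m) i)

decodePair-encodePair : (x : Fin n × Subset m) → decodePair {n} {m} (encodePair x) ≡ x
decodePair-encodePair (q , s) =
  trans (cong (map₂ decodeSubset) (remQuot-combine q (encodeSubset s)))
        (cong (q ,_) (decodeSubset-encodeSubset s))

emptyRegisters : Regs X m → Subset m
emptyRegisters f = tabulate (null ∘ f)

∈-emptyRegisters⇔ : {f : Regs X m} {r : Fin m} → r ∈ₛ emptyRegisters f ⇔ f r ≡ []
∈-emptyRegisters⇔ = T-null⇔≡[] ⇔-∘ ∈-tabulate⇔

⊆-emptyRegisters⇔ : {f : Regs X m} {s : Subset m} → s ⊆ emptyRegisters f ⇔ (∀ r → r ∈ₛ s → f r ≡ [])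
⊆-emptyRegisters⇔ = mk⇔ (λ s⊆ r r∈s → to ∈-emptyRegisters⇔ (s⊆ r∈s))
                        (λ empty {r} r∈s → from ∈-emptyRegisters⇔ (empty r r∈s))

nextEmptyRegisters : (Fin m → Subset m) → (Fin m → Bool) → Subset m → Subset m
nextEmptyRegisters {m} upR upIn E =
  tabulate λ r → all (λ r' → not ⌊ r' ∈? upR r ⌋ ∨ lookup E r') (allFin m) ∧ not (upIn r)

emptyRegisters-update : (upR : Fin m → Subset m) (upIn : Fin m → Bool) (f : Regs X m) (d : X) →
  emptyRegisters (update upR upIn f d) ≡ nextEmptyRegisters upR upIn (emptyRegisters f)
emptyRegisters-update {m = m} {X = X} upR upIn f d = tabulate-cong λ r → begin
  null (concatMap (copied r) (allFin m) ++ (if upIn r then d ∷ [] else []))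
    ≡⟨ null-++ (concatMap (copied r) (allFin m)) _ ⟩
  null (concatMap (copied r) (allFin m)) ∧ null (if upIn r then d ∷ [] else [])
    ≡⟨ cong₂ _∧_ (null-concatMap (copied r) (allFin m))
                 (trans (null-if (upIn r) (d ∷ [])) (∨-identityʳ (not (upIn r)))) ⟩
  all (null ∘ copied r) (allFin m) ∧ not (upIn r)
    ≡⟨ cong (λ b → and b ∧ not (upIn r)) (map-cong (null-copied r) (allFin m)) ⟩
  all (λ r' → not ⌊ r' ∈? upR r ⌋ ∨ lookup (emptyRegisters f) r') (allFin m) ∧ not (upIn r) ∎
  where
  open ≡-Reasoning
  copied : Fin m → Fin m → List X
  copied r r' = if ⌊ r' ∈? upR r ⌋ then f r' else []
  null-copied : ∀ r r' → null (copied r r') ≡ not ⌊ r' ∈? upR r ⌋ ∨ lookup (emptyRegisters f) r'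
  null-copied r r' =
    trans (null-if _ (f r')) (cong (not ⌊ r' ∈? upR r ⌋ ∨_) (sym (lookup∘tabulate (null ∘ f) r')))

module EmptinessTracking {Sig : Set} (𝒜 : RsAE Sig) where
  open RsAE 𝒜

  N : ℕ
  N = nQ * 2 ^ nR

  decode : Fin N → Fin nQ × Subset nR
  decode = decodePair {nQ} {nR}

  encode : Fin nQ × Subset nR → Fin N
  encode = encodePair

  Guarded : TransE Sig nQ nR × Subset nR → Set
  Guarded (t , E) = TransE.gEmpty t ⊆ E

  guarded? : Decidable Guarded
  guarded? (t , E) = TransE.gEmpty t ⊆? E

  track : TransE Sig nQ nR × Subset nR → Trans Sig N nR
  track (t , E) = record
    { src = encode (src , E) ; lab = lab ; gIn = gIn ; gNotIn = gNotIn ; disj = disj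
    ; upR = upR ; upIn = upIn ; tgt = encode (tgt , nextEmptyRegisters upR upIn E) }
    where open TransE t

  -- Definitionally equal to emptyRegisters emptyRegs, over every data domain.
  allEmpty : Subset nR
  allEmpty = tabulate λ _ → true

  tracking : RsA Sig
  tracking = record
    { nQ = N
    ; nR = nR
    ; Δ  = map track (filter guarded? (cartesianProduct Δ (subsets nR)))
    ; I  = preimage (proj₁ ∘ decode) I ∩ tabulate (λ i → ⌊ ≡-dec _≟ᵇ_ (proj₂ (decode i)) allEmpty ⌋)
    ; F  = preimage (proj₁ ∘ decode) F
    }

  ∈-Δ⁺ : ∀ {t E} → t ∈ₗ Δ → TransE.gEmpty t ⊆ E → track (t , E) ∈ₗ RsA.Δ tracking
  ∈-Δ⁺ {E = E} t∈Δ guard =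
    ∈-map⁺ track (∈-filter⁺ guarded? (∈-cartesianProduct⁺ t∈Δ (∈-subsets E)) guard)

  ∈-Δ⁻ : ∀ {t'} → t' ∈ₗ RsA.Δ tracking →
         ∃ λ ((t , E) : TransE Sig nQ nR × Subset nR) → t ∈ₗ Δ × TransE.gEmpty t ⊆ E × t' ≡ track (t , E)
  ∈-Δ⁻ t'∈Δ
    with (t , E) , tE∈ , refl ← ∈-map⁻ track t'∈Δ
    with tE∈Δ×subsets , guard ← ∈-filter⁻ guarded? tE∈
    = (t , E) , proj₁ (∈-cartesianProduct⁻ Δ (subsets nR) tE∈Δ×subsets) , guard , refl

  liftRun : ∀ {D q} {f : Regs D nR} {w} →
            AccRsAE 𝒜 q f w → AccRsA tracking (encode (q , emptyRegisters f)) f w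
  liftRun {q = q} {f} (done q∈F) =
    done (from ∈-preimage⇔ (subst (_∈ₛ F) (sym (cong proj₁ (decodePair-encodePair (q , emptyRegisters f)))) q∈F))
  liftRun {f = f} (step {d = d} {w} t t∈Δ refl refl inG notInG emptyG run) =
    step (track (t , emptyRegisters f)) (∈-Δ⁺ t∈Δ (from ⊆-emptyRegisters⇔ emptyG)) refl refl inG notInG
      (subst (λ E → AccRsA tracking (encode (tgt , E)) (update upR upIn f d) w)
             (emptyRegisters-update upR upIn f d) (liftRun run))
    where open TransE t

  lowerRun : ∀ {D i q} {f : Regs D nR} {w} →
             AccRsA tracking i f w → decode i ≡ (q , emptyRegisters f) → AccRsAE 𝒜 q f w
  lowerRun (done i∈F) decode-i = done (subst (_∈ₛ F) (cong proj₁ decode-i) (to ∈-preimage⇔ i∈F))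
  lowerRun {f = f} (step {d = d} t' t'∈Δ refl refl inG notInG run) decode-i
    with (t , E) , t∈Δ , guard , refl ← ∈-Δ⁻ t'∈Δ
    with refl ← trans (sym (decodePair-encodePair (TransE.src t , E))) decode-i
    = step t t∈Δ refl refl inG notInG (to ⊆-emptyRegisters⇔ guard)
        (lowerRun run (trans (decodePair-encodePair _)
          (cong (TransE.tgt t ,_) (sym (emptyRegisters-update (TransE.upR t) (TransE.upIn t) f d)))))

  tracking-correct : ∀ {D} (w : DataWord Sig D) → LangRsA tracking w ⇔ LangRsAE 𝒜 w
  tracking-correct w = mk⇔ lower lift
    where
    lower : LangRsA tracking w → LangRsAE 𝒜 w
    lower (i , i∈I , run) =
      let q∈I , initialEmpty = x∈p∩q⁻ _ _ i∈I
      in proj₁ (decode i) , to ∈-preimage⇔ q∈I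
       , lowerRun run (cong (proj₁ (decode i) ,_) (toWitness (to ∈-tabulate⇔ initialEmpty)))
    lift : LangRsAE 𝒜 w → LangRsA tracking w
    lift (q , q∈I , run) =
      encode (q , allEmpty)
      , x∈p∩q⁺ ( from ∈-preimage⇔ (subst (_∈ₛ I) (sym (cong proj₁ decode-encode)) q∈I)
               , from ∈-tabulate⇔ (fromWitness (cong proj₂ decode-encode)))
      , liftRun run
      where
      decode-encode : decode (encode (q , allEmpty)) ≡ (q , allEmpty)
      decode-encode = decodePair-encodePair (q , allEmpty)

lemma7p1 : (Sig D : Set) → FiniteNonempty Sig → Infinite D →
    (𝒜 : RsAE Sig) →
    Σ (RsA Sig) λ 𝒜' → (w : DataWord Sig D) → LangRsA 𝒜' w ⇔ LangRsAE 𝒜 w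
lemma7p1 Sig D _ _ 𝒜 = tracking , tracking-correct
  where open EmptinessTracking 𝒜
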